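{- Let $G$ be a digraph and let $W$ be a walk cover of $G$, and let $K$ be the set of lengths $k$ such that $W$ contains a walk of length $k$. Then the directed line graph $L(G)$ has a walk cover all of whose walks have lengths in $K+1=\{k+1\mid k\in K\}$.
   Context: Walks may repeat vertices and edges; the length of a walk is its number of edges (a single vertex is a walk of length $0$). A walk cover of a digraph $G$ is a set $W$ of walks such that for every ordered pair of vertices $(u,v)$, where $u=v$ is allowed, $W$ contains exactly one walk from $u$ to $v$. The directed line graph $L(G)$ of $G=(V,E)$ has vertex set $E$ and a directed edge from $(u,v)$ to $(v,w)$ for every pair of edges $(u,v),(v,w)\in E$. -}

module Defs where

open import Data.Nat using (ℕ; zero; suc)
open import Data.Fin using (Fin)
open import Data.Bool using (Bool; true)
open import Data.Product using (Σ; _×_; _,_; ∃-syntax)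
open import Relation.Binary.PropositionalEquality using (_≡_)

-- A finite (simple) digraph on vertex set Fin n, given by its adjacency
-- relation: there is an edge u → v iff adj u v ≡ true (loops allowed).
Digraph : ℕ → Set
Digraph n = Fin n → Fin n → Bool

data Walk {V : Set} (E : V → V → Set) : V → V → Set where
  [_]  : (v : V) → Walk E v v
  _∷_ : {u v w : V} → E u v → Walk E v w → Walk E u w

length : {V : Set} {E : V → V → Set} {u v : V} → Walk E u v → ℕ
length [ v ]    = zero
length (e ∷ p) = suc (length p)

-- A set of walks containing exactly one walk from u to v for each (u , v)
-- is the same thing as a choice of one walk per ordered pair.
WalkCover : (V : Set) (E : V → V → Set) → Set
WalkCover V E = (u v : V) → Walk E u v

InLengths : {V : Set} {E : V → V → Set} → WalkCover V E → ℕ → Set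
InLengths {V} W k = ∃[ u ] ∃[ v ] (length (W u v) ≡ k)

Edge : {n : ℕ} → Digraph n → Fin n → Fin n → Set
Edge G u v = G u v ≡ true

LVertex : {n : ℕ} → Digraph n → Set
LVertex {n} G = Σ (Fin n × Fin n) (λ { (u , v) → Edge G u v })

LEdge : {n : ℕ} (G : Digraph n) → LVertex G → LVertex G → Set
LEdge G ((u , v) , _) ((v' , w) , _) = v ≡ v'

{-# OPTIONS --safe #-}
module Submission where

-- A walk b ⇝ c in G, extended by an edge a → b in front and an edge c → d
-- behind, visits the consecutive edges (a,b), (b,x), …, (c,d): a walk of
-- L(G) from (a,b) to (c,d) with exactly one more edge. Doing this for the
-- walk W b c of the cover, for every pair of edges, gives a walk cover of L(G).

open import Defs
open import Data.Nat using (ℕ; suc)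
open import Data.Fin using (Fin)
open import Data.Product using (_×_; ∃-syntax; _,_)
open import Relation.Binary.PropositionalEquality using (_≡_; refl; cong)

module _ {n : ℕ} (G : Digraph n) where

  toLineWalk : ∀ {a b c d} (ab : Edge G a b) → Walk (Edge G) b c → (cd : Edge G c d) →
               Walk (LEdge G) ((a , b) , ab) ((c , d) , cd)
  toLineWalk ab [ _ ]     cd = refl ∷ [ _ ]
  toLineWalk ab (bx ∷ p) cd = refl ∷ toLineWalk bx p cd

  length-toLineWalk : ∀ {a b c d} (ab : Edge G a b) (p : Walk (Edge G) b c) (cd : Edge G c d) →
                      length (toLineWalk ab p cd) ≡ suc (length p)
  length-toLineWalk ab [ _ ]     cd = refl
  length-toLineWalk ab (bx ∷ p) cd = cong suc (length-toLineWalk bx p cd)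

  lineWalkCover : WalkCover (Fin n) (Edge G) → WalkCover (LVertex G) (LEdge G)
  lineWalkCover W ((a , b) , ab) ((c , d) , cd) = toLineWalk ab (W b c) cd

theorem3 : (n : ℕ) (G : Digraph n) (W : WalkCover (Fin n) (Edge G)) →
    ∃[ W′ ] ((k : ℕ) → InLengths {LVertex G} {LEdge G} W′ k →
      ∃[ j ] (InLengths {E = Edge G} W j × k ≡ suc j))
theorem3 n G W = lineWalkCover G W , lengths
  where
  lengths : (k : ℕ) → InLengths {LVertex G} {LEdge G} (lineWalkCover G W) k →
            ∃[ j ] (InLengths {E = Edge G} W j × k ≡ suc j)
  lengths k (((a , b) , ab) , ((c , d) , cd) , refl) =
    length (W b c) , (b , c , refl) , length-toLineWalk G ab (W b c) cd
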